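{- The set of closed terms $t\in\mathrm{Tm}(\mathsf{Untyped})$ whose associated closed untyped $\lambda$-term is affine is $\mathbf{FinSet}$-recognizable: there exist a finite set $Q$ and a subset $F\subseteq[\![\mathsf{Untyped}]\!]_Q$ such that this set equals $\{t\in\mathrm{Tm}(\mathsf{Untyped})\mid[\![t]\!]_Q\in F\}$.
   Context: Simple types: $A ::= o \mid A\to B \mid A\times B \mid 1$; $\mathrm{Tm}(A)$ is the set of closed simply typed $\lambda$-terms of type $A$ modulo $\beta\eta$; for a finite set $Q$, $[\![A]\!]_Q$ and $[\![t]\!]_Q$ are the standard set-theoretic interpretations with $[\![o]\!]_Q = Q$. Let $\mathsf{Untyped}:=((o\to o)\to o)\to(o\to o\to o)\to o$. Untyped terms with de Bruijn indices are $u,v ::= \underline{i}\ (i\ge 1)\mid \mathsf{abs}(u)\mid \mathsf{app}(u,v)$; a scoped term $n\vdash u$ is derivable by: $n\vdash\underline{i}$ if $1\le i\le n$; $n\vdash\mathsf{abs}(u)$ if $n+1\vdash u$; $n\vdash\mathsf{app}(u,v)$ if $n\vdash u$ and $n\vdash v$. A closed untyped term is a $u$ with $0\vdash u$. With variables $\ell:(o\to o)\to o$, $a:o\to o\to o$, $x_1,x_2,\dots:o$, encode $\langle n\vdash\underline{i}\rangle := x_{n+1-i}$, $\langle n\vdash\mathsf{abs}(u)\rangle:=\ell\,(\lambda(x_{n+1}:o).\,\langle n+1\vdash u\rangle)$, $\langle n\vdash\mathsf{app}(u,v)\rangle:=a\,\langle n\vdash u\rangle\,\langle n\vdash v\rangle$;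 the map $u\mapsto\lambda\ell.\lambda a.\langle 0\vdash u\rangle$ is a bijection from closed untyped terms onto $\mathrm{Tm}(\mathsf{Untyped})$, giving the closed untyped term associated with each $t\in\mathrm{Tm}(\mathsf{Untyped})$. For $n\vdash u$ and $1\le i\le n$, $\mathrm{occ}_i$ counts occurrences of the $i$-th variable: $\mathrm{occ}_i(n\vdash\underline{j})$ is $1$ if $i=j$ else $0$; $\mathrm{occ}_i(n\vdash\mathsf{abs}(u)) = \mathrm{occ}_{i+1}(n+1\vdash u)$; $\mathrm{occ}_i(n\vdash\mathsf{app}(u,v))=\mathrm{occ}_i(n\vdash u)+\mathrm{occ}_i(n\vdash v)$. A scoped term is affine in its bound variables: always for $\underline{i}$; for $\mathsf{abs}(u)$ iff $\mathrm{occ}_1(n+1\vdash u)\le 1$ and $n+1\vdash u$ is affine in its bound variables; for $\mathsf{app}(u,v)$ iff both $n\vdash u$ and $n\vdash v$ are. A closed untyped term $u$ is affine iff $0\vdash u$ is affine in its bound variables (i.e. every bound variable occurs at most once). -}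

module Defs where

open import Data.Nat using (ℕ; zero; suc; _+_; _≤_)
open import Data.Fin using (Fin; zero; suc)
open import Data.List using (List; []; _∷_; replicate; _++_)
open import Data.Product using (_×_; _,_; proj₁; proj₂)
open import Data.Unit using (⊤; tt)

infixr 7 _⇒_
infixr 8 _⊗_

data Ty : Set where
  o   : Ty
  _⇒_ : Ty → Ty → Ty
  _⊗_ : Ty → Ty → Ty
  𝟙   : Ty

Ctx : Set
Ctx = List Ty

data _∋_ : Ctx → Ty → Set where
  here  : ∀ {Γ A} → (A ∷ Γ) ∋ A
  there : ∀ {Γ A B} → Γ ∋ A → (B ∷ Γ) ∋ A

-- intrinsically typed simply typed λ-terms (raw, not quotiented)
data Tm : Ctx → Ty → Set where
  var  : ∀ {Γ A} → Γ ∋ A → Tm Γ A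
  lam  : ∀ {Γ A B} → Tm (A ∷ Γ) B → Tm Γ (A ⇒ B)
  app  : ∀ {Γ A B} → Tm Γ (A ⇒ B) → Tm Γ A → Tm Γ B
  pair : ∀ {Γ A B} → Tm Γ A → Tm Γ B → Tm Γ (A ⊗ B)
  fst  : ∀ {Γ A B} → Tm Γ (A ⊗ B) → Tm Γ A
  snd  : ∀ {Γ A B} → Tm Γ (A ⊗ B) → Tm Γ B
  unit : ∀ {Γ} → Tm Γ 𝟙

⟦_⟧T : Ty → Set → Set
⟦ o ⟧T Q     = Q
⟦ A ⇒ B ⟧T Q = ⟦ A ⟧T Q → ⟦ B ⟧T Q
⟦ A ⊗ B ⟧T Q = ⟦ A ⟧T Q × ⟦ B ⟧T Q
⟦ 𝟙 ⟧T Q     = ⊤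

⟦_⟧C : Ctx → Set → Set
⟦ [] ⟧C Q    = ⊤
⟦ A ∷ Γ ⟧C Q = ⟦ A ⟧T Q × ⟦ Γ ⟧C Q

lookupEnv : ∀ {Q Γ A} → Γ ∋ A → ⟦ Γ ⟧C Q → ⟦ A ⟧T Q
lookupEnv here      (x , _) = x
lookupEnv (there v) (_ , ρ) = lookupEnv v ρ

⟦_⟧ : ∀ {Q Γ A} → Tm Γ A → ⟦ Γ ⟧C Q → ⟦ A ⟧T Q
⟦ var v ⟧    ρ = lookupEnv v ρ
⟦ lam t ⟧    ρ = λ x → ⟦ t ⟧ (x , ρ)
⟦ app t s ⟧  ρ = ⟦ t ⟧ ρ (⟦ s ⟧ ρ)
⟦ pair t s ⟧ ρ = ⟦ t ⟧ ρ , ⟦ s ⟧ ρ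
⟦ fst t ⟧    ρ = proj₁ (⟦ t ⟧ ρ)
⟦ snd t ⟧    ρ = proj₂ (⟦ t ⟧ ρ)
⟦ unit ⟧     ρ = tt

⟦_⟧₀ : ∀ {Q A} → Tm [] A → ⟦ A ⟧T Q
⟦ t ⟧₀ = ⟦ t ⟧ tt

LamTy : Ty
LamTy = (o ⇒ o) ⇒ o

AppTy : Ty
AppTy = o ⇒ o ⇒ o

Untyped : Ty
Untyped = LamTy ⇒ AppTy ⇒ o

-- Scoped untyped λ-terms with de Bruijn indices:  Λ n  is the type of
-- u with n ⊢ u.  The index  i  (1 ≤ i ≤ n) is  Fin n  element  i - 1,
-- so  zero : Fin n  is the index 1 (innermost binder).

data Λ (n : ℕ) : Set where
  ix  : Fin n → Λ n
  abs : Λ (suc n) → Λ n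
  ap  : Λ n → Λ n → Λ n

Closed : Set
Closed = Λ 0

δ : ∀ {n} → Fin n → Fin n → ℕ
δ zero    zero    = 1
δ zero    (suc _) = 0
δ (suc _) zero    = 0
δ (suc i) (suc j) = δ i j

occ : ∀ {n} → Fin n → Λ n → ℕ
occ i (ix j)   = δ i j
occ i (abs u)  = occ (suc i) u
occ i (ap u v) = occ i u + occ i v

AffineBV : ∀ {n} → Λ n → Set
AffineBV (ix _)   = ⊤
AffineBV (abs u)  = (occ zero u ≤ 1) × AffineBV u
AffineBV (ap u v) = AffineBV u × AffineBV v

Affine : Closed → Set
Affine u = AffineBV u

-- Encoding  ⟨ n ⊢ u ⟩  in the context  ℓ : LamTy, a : AppTy, x₁ … xₙ : o
-- (x_n most recent, so the untyped index i is x_{n+1-i}).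

EncCtx : ℕ → Ctx
EncCtx n = replicate n o ++ (AppTy ∷ LamTy ∷ [])

encVar : ∀ {n} → Fin n → EncCtx n ∋ o
encVar zero    = here
encVar (suc i) = there (encVar i)

encℓ : ∀ n → EncCtx n ∋ LamTy
encℓ zero    = there here
encℓ (suc n) = there (encℓ n)

enca : ∀ n → EncCtx n ∋ AppTy
enca zero    = here
enca (suc n) = there (enca n)

enc : ∀ {n} → Λ n → Tm (EncCtx n) o
enc {n} (ix i)   = var (encVar i)
enc {n} (abs u)  = app (var (encℓ n)) (lam (enc u))
enc {n} (ap u v) = app (app (var (enca n)) (enc u)) (enc v)

-- the bijection  closed untyped terms ≅ Tm(Untyped):  u ↦ λℓ.λa.⟨0 ⊢ u⟩
toTm : Closed → Tm [] Untyped
toTm u = lam (lam (enc u))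

-- Interpret o as {0, 1, 2}, read as a number of occurrences saturated at 2: a is saturated
-- addition and ℓ f = absorb (f 0) (f 1).  An affine term then denotes the saturated sum of
-- the values of its free variable occurrences (mass).  Probing the body of λx.u at x = 0 and
-- at x = 1 gives two counts differing exactly by occ x, so when the rest of the body
-- contributes 0, a duplicated x makes absorb return 2.  Nothing nonzero becomes 0 again on
-- the way to the root, hence a closed term is affine iff it denotes 0.
module Submission where

open import Defs
open import Data.Nat using (ℕ; zero; suc; _+_; _≤_; z≤n; s≤s)
open import Data.Nat.Properties using (+-identityʳ; m+n≡0⇒m≡0; m+n≡0⇒n≡0; +-commutativeSemigroup)
open import Data.Fin using (Fin; zero; suc; toℕ)
open import Data.Vec.Functional using (Vector; []; _∷_; head; tail)
open import Data.Product using (Σ; ∃-syntax; _×_; _,_)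
open import Data.Unit using (tt)
open import Function using (_∘_)
open import Function.Bundles using (_⇔_; mk⇔)
open import Relation.Binary.PropositionalEquality
open import Algebra.Properties.CommutativeSemigroup +-commutativeSemigroup using (interchange)

-- Without function extensionality, ℓ must be assumed to respect pointwise equality.
module Encoding {Q : Set} (lamQ : (Q → Q) → Q) (appQ : Q → Q → Q)
                (lamQ-cong : ∀ {f g} → (∀ x → f x ≡ g x) → lamQ f ≡ lamQ g) where

  eval : ∀ {n} → Vector Q n → Λ n → Q
  eval ρ (ix i)   = ρ i
  eval ρ (abs u)  = lamQ (λ x → eval (x ∷ ρ) u)
  eval ρ (ap u v) = appQ (eval ρ u) (eval ρ v)

  encEnv : ∀ n → Vector Q n → ⟦ EncCtx n ⟧C Q
  encEnv zero    ρ = appQ , lamQ , tt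
  encEnv (suc n) ρ = head ρ , encEnv n (tail ρ)

  lookup-encVar : ∀ {n} (i : Fin n) (ρ : Vector Q n) → lookupEnv (encVar i) (encEnv n ρ) ≡ ρ i
  lookup-encVar zero    ρ = refl
  lookup-encVar (suc i) ρ = lookup-encVar i (tail ρ)

  lookup-encℓ : ∀ n (ρ : Vector Q n) → lookupEnv (encℓ n) (encEnv n ρ) ≡ lamQ
  lookup-encℓ zero    ρ = refl
  lookup-encℓ (suc n) ρ = lookup-encℓ n (tail ρ)

  lookup-enca : ∀ n (ρ : Vector Q n) → lookupEnv (enca n) (encEnv n ρ) ≡ appQ
  lookup-enca zero    ρ = refl
  lookup-enca (suc n) ρ = lookup-enca n (tail ρ)

  ⟦enc⟧≡eval : ∀ {n} (ρ : Vector Q n) (u : Λ n) → ⟦ enc u ⟧ (encEnv n ρ) ≡ eval ρ u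
  ⟦enc⟧≡eval ρ (ix i) = lookup-encVar i ρ
  ⟦enc⟧≡eval {n} ρ (abs u) = begin
    lookupEnv (encℓ n) (encEnv n ρ) (λ x → ⟦ enc u ⟧ (x , encEnv n ρ))
      ≡⟨ cong-app (lookup-encℓ n ρ) _ ⟩
    lamQ (λ x → ⟦ enc u ⟧ (x , encEnv n ρ))
      ≡⟨ lamQ-cong (λ x → ⟦enc⟧≡eval (x ∷ ρ) u) ⟩
    lamQ (λ x → eval (x ∷ ρ) u) ∎
    where open ≡-Reasoning
  ⟦enc⟧≡eval {n} ρ (ap u v) = begin
    lookupEnv (enca n) (encEnv n ρ) (⟦ enc u ⟧ (encEnv n ρ)) (⟦ enc v ⟧ (encEnv n ρ))
      ≡⟨ cong-app (cong-app (lookup-enca n ρ) _) _ ⟩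
    appQ (⟦ enc u ⟧ (encEnv n ρ)) (⟦ enc v ⟧ (encEnv n ρ))
      ≡⟨ cong₂ appQ (⟦enc⟧≡eval ρ u) (⟦enc⟧≡eval ρ v) ⟩
    appQ (eval ρ u) (eval ρ v) ∎
    where open ≡-Reasoning

pattern one = suc zero
pattern two = suc (suc zero)

sat : ℕ → Fin 3
sat zero          = zero
sat (suc zero)    = one
sat (suc (suc _)) = two

_⊕_ : Fin 3 → Fin 3 → Fin 3
x ⊕ y = sat (toℕ x + toℕ y)

absorb : Fin 3 → Fin 3 → Fin 3
absorb zero zero = zero
absorb zero one  = zero
absorb zero two  = two
absorb one  _    = one
absorb two  _    = two

lam₃ : (Fin 3 → Fin 3) → Fin 3
lam₃ f = absorb (f zero) (f one)

lam₃-cong : ∀ {f g} → (∀ x → f x ≡ g x) → lam₃ f ≡ lam₃ g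
lam₃-cong f≗g = cong₂ absorb (f≗g zero) (f≗g one)

open Encoding lam₃ _⊕_ lam₃-cong

sat-toℕ : (x : Fin 3) → sat (toℕ x) ≡ x
sat-toℕ zero = refl
sat-toℕ one  = refl
sat-toℕ two  = refl

sat-⊕ : ∀ m n → sat m ⊕ sat n ≡ sat (m + n)
sat-⊕ zero          n             = sat-toℕ (sat n)
sat-⊕ (suc zero)    zero          = refl
sat-⊕ (suc zero)    (suc zero)    = refl
sat-⊕ (suc zero)    (suc (suc n)) = refl
sat-⊕ (suc (suc m)) n             = refl

⊕≡zero⇒ : ∀ x y → x ⊕ y ≡ zero → x ≡ zero × y ≡ zero
⊕≡zero⇒ zero zero _ = refl , refl
⊕≡zero⇒ zero one ()
⊕≡zero⇒ zero two ()
⊕≡zero⇒ one  zero ()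
⊕≡zero⇒ one  one ()
⊕≡zero⇒ one  two ()
⊕≡zero⇒ two  _ ()

absorb≡zero⇒ : ∀ x y → absorb x y ≡ zero → x ≡ zero
absorb≡zero⇒ zero _   _  = refl
absorb≡zero⇒ one  _   ()
absorb≡zero⇒ two  _   ()

absorb-sat : ∀ c {k} → k ≤ 1 → absorb (sat c) (sat (c + k)) ≡ sat c
absorb-sat zero          z≤n       = refl
absorb-sat zero          (s≤s z≤n) = refl
absorb-sat (suc zero)    _         = refl
absorb-sat (suc (suc c)) _         = refl

absorb-zero-sat≡zero⇒ : ∀ k → absorb zero (sat k) ≡ zero → k ≤ 1
absorb-zero-sat≡zero⇒ zero       _ = z≤n
absorb-zero-sat≡zero⇒ (suc zero) _ = s≤s z≤n

-- Σᵢ toℕ (ρ i) · occᵢ u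
mass : ∀ {n} → Vector (Fin 3) n → Λ n → ℕ
mass ρ (ix i)   = toℕ (ρ i)
mass ρ (abs u)  = mass (zero ∷ ρ) u
mass ρ (ap u v) = mass ρ u + mass ρ v

mass-zeros : ∀ {n} (ρ : Vector (Fin 3) n) → (∀ i → ρ i ≡ zero) → (u : Λ n) → mass ρ u ≡ 0
mass-zeros ρ ρ≡0 (ix i)   = cong toℕ (ρ≡0 i)
mass-zeros ρ ρ≡0 (abs u)  = mass-zeros (zero ∷ ρ) (λ { zero → refl ; (suc i) → ρ≡0 i }) u
mass-zeros ρ ρ≡0 (ap u v) = cong₂ _+_ (mass-zeros ρ ρ≡0 u) (mass-zeros ρ ρ≡0 v)

mass-+δ : ∀ {n} (ρ ρ′ : Vector (Fin 3) n) i →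
          (∀ j → toℕ (ρ′ j) ≡ toℕ (ρ j) + δ i j) →
          (u : Λ n) → mass ρ′ u ≡ mass ρ u + occ i u
mass-+δ ρ ρ′ i ρ′≡ρ+δ (ix j)   = ρ′≡ρ+δ j
mass-+δ ρ ρ′ i ρ′≡ρ+δ (abs u)  =
  mass-+δ (zero ∷ ρ) (zero ∷ ρ′) (suc i) (λ { zero → refl ; (suc j) → ρ′≡ρ+δ j }) u
mass-+δ ρ ρ′ i ρ′≡ρ+δ (ap u v) = begin
  mass ρ′ u + mass ρ′ v
    ≡⟨ cong₂ _+_ (mass-+δ ρ ρ′ i ρ′≡ρ+δ u) (mass-+δ ρ ρ′ i ρ′≡ρ+δ v) ⟩
  (mass ρ u + occ i u) + (mass ρ v + occ i v)
    ≡⟨ interchange (mass ρ u) (occ i u) (mass ρ v) (occ i v) ⟩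
  (mass ρ u + mass ρ v) + (occ i u + occ i v) ∎
  where open ≡-Reasoning

mass-one∷ : ∀ {n} (ρ : Vector (Fin 3) n) (u : Λ (suc n)) →
            mass (one ∷ ρ) u ≡ mass (zero ∷ ρ) u + occ zero u
mass-one∷ ρ = mass-+δ (zero ∷ ρ) (one ∷ ρ) zero
  (λ { zero → refl ; (suc j) → sym (+-identityʳ (toℕ (ρ j))) })

eval-affine : ∀ {n} (ρ : Vector (Fin 3) n) (u : Λ n) → AffineBV u → eval ρ u ≡ sat (mass ρ u)
eval-affine ρ (ix i) _ = sym (sat-toℕ (ρ i))
eval-affine ρ (abs u) (occ≤1 , u-affine) = begin
  absorb (eval (zero ∷ ρ) u) (eval (one ∷ ρ) u)
    ≡⟨ cong₂ absorb (eval-affine (zero ∷ ρ) u u-affine) (eval-affine (one ∷ ρ) u u-affine) ⟩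
  absorb (sat (mass (zero ∷ ρ) u)) (sat (mass (one ∷ ρ) u))
    ≡⟨ cong (absorb (sat (mass (zero ∷ ρ) u)) ∘ sat) (mass-one∷ ρ u) ⟩
  absorb (sat (mass (zero ∷ ρ) u)) (sat (mass (zero ∷ ρ) u + occ zero u))
    ≡⟨ absorb-sat (mass (zero ∷ ρ) u) occ≤1 ⟩
  sat (mass (zero ∷ ρ) u) ∎
  where open ≡-Reasoning
eval-affine ρ (ap u v) (u-affine , v-affine) = begin
  eval ρ u ⊕ eval ρ v
    ≡⟨ cong₂ _⊕_ (eval-affine ρ u u-affine) (eval-affine ρ v v-affine) ⟩
  sat (mass ρ u) ⊕ sat (mass ρ v)
    ≡⟨ sat-⊕ (mass ρ u) (mass ρ v) ⟩
  sat (mass ρ u + mass ρ v) ∎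
  where open ≡-Reasoning

eval≡zero⇒affine : ∀ {n} (ρ : Vector (Fin 3) n) (u : Λ n) →
                   mass ρ u ≡ 0 → eval ρ u ≡ zero → AffineBV u
eval≡zero⇒affine ρ (ix i) _ _ = tt
eval≡zero⇒affine ρ (abs u) mass≡0 eval≡0 = occ≤1 , u-affine
  where
  body₀≡0 : eval (zero ∷ ρ) u ≡ zero
  body₀≡0 = absorb≡zero⇒ _ _ eval≡0

  u-affine : AffineBV u
  u-affine = eval≡zero⇒affine (zero ∷ ρ) u mass≡0 body₀≡0

  body₁≡sat-occ : eval (one ∷ ρ) u ≡ sat (occ zero u)
  body₁≡sat-occ = begin
    eval (one ∷ ρ) u                        ≡⟨ eval-affine (one ∷ ρ) u u-affine ⟩
    sat (mass (one ∷ ρ) u)                  ≡⟨ cong sat (mass-one∷ ρ u) ⟩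
    sat (mass (zero ∷ ρ) u + occ zero u)    ≡⟨ cong (λ m → sat (m + occ zero u)) mass≡0 ⟩
    sat (occ zero u) ∎
    where open ≡-Reasoning

  occ≤1 : occ zero u ≤ 1
  occ≤1 = absorb-zero-sat≡zero⇒ (occ zero u)
    (subst₂ (λ x y → absorb x y ≡ zero) body₀≡0 body₁≡sat-occ eval≡0)
eval≡zero⇒affine ρ (ap u v) mass≡0 eval≡0 =
  let u≡0 , v≡0 = ⊕≡zero⇒ (eval ρ u) (eval ρ v) eval≡0 in
  eval≡zero⇒affine ρ u (m+n≡0⇒m≡0 (mass ρ u) mass≡0) u≡0 ,
  eval≡zero⇒affine ρ v (m+n≡0⇒n≡0 (mass ρ u) mass≡0) v≡0

theoremA10 : ∃[ q ] Σ (⟦ Untyped ⟧T (Fin q) → Set) λ F →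
               (u : Closed) → Affine u ⇔ F (⟦ toTm u ⟧₀)
theoremA10 = 3 , (λ t → t lam₃ _⊕_ ≡ zero) , λ u →
  let mass≡0 = mass-zeros [] (λ ()) u
      ⟦u⟧≡eval = ⟦enc⟧≡eval [] u
  in mk⇔ (λ u-affine → trans ⟦u⟧≡eval (trans (eval-affine [] u u-affine) (cong sat mass≡0)))
         (λ ⟦u⟧≡0 → eval≡zero⇒affine [] u mass≡0 (trans (sym ⟦u⟧≡eval) ⟦u⟧≡0))
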